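{- Let $q$ be a prime power, $F_q$ the field with $q$ elements, $V=F_q^n$, and $1<k<n-1$. Let $S$ be a $(k-1)$-dimensional subspace of $V$ having a generator matrix of the form $M=[I_{k-1}\ A]$, where $I_{k-1}$ is the $(k-1)\times(k-1)$ identity matrix and $A$ is a $(k-1)\times(n-k+1)$ matrix over $F_q$. Let $W$ be the set of all vectors $w\in V$ whose first $k-1$ coordinates are $0$ and such that the matrix obtained by appending $w$ as a last row to $M$ generates a $k$-dimensional projective code. If $\dim\langle W\rangle=1$, then $[S\rangle^{\Pi}_{k}$ is not a maximal clique of the graph $\Pi[n,k]_q$.
   Context: A linear code $[n,k]_q$ is a $k$-dimensional subspace of $V=F_q^n$; a generator matrix is a matrix whose rows form a basis of it. A code is projective if the columns of a generator matrix are non-zero and pairwise non-proportional. $\Pi(n,k)_q$ denotes the set of all $k$-dimensional projective codes in $V$, and $\Pi[n,k]_q$ is the simple graph with vertex set $\Pi(n,k)_q$ in which two distinct codes are adjacent iff their intersection is $(k-1)$-dimensional. A clique is a set of pairwise adjacent vertices; it is maximal if it is not properly contained in another clique. $[S\rangle^{\Pi}_{k}$ denotes the set of all elements of $\Pi(n,k)_q$ containing $S$. -}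

module Defs where

import Level
open import Level using (0ℓ; Lift)
open import Data.Nat using (ℕ; zero; suc; _<_; _≟_)
open import Data.Fin using (Fin; toℕ) renaming (zero to fz; suc to fs)
open import Data.Product using (Σ; _×_; _,_; ∃)
open import Data.Bool using (if_then_else_)
open import Relation.Nullary using (¬_; does)
open import Relation.Binary.PropositionalEquality using (_≡_)
open import Function.Bundles using (_↔_; _⇔_)
open import Algebra.Structures using (IsCommutativeRing)

-- Every finite field has prime-power order
-- q = size, and every prime power occurs, so quantifying over all
-- FiniteField records is quantifying over all F_q, q a prime power.

record FiniteField : Set₁ where
  infixl 6 _+_
  infixl 7 _*_
  field
    Carrier : Set
    _+_ _*_ : Carrier → Carrier → Carrier
    -_      : Carrier → Carrier
    0# 1#   : Carrier
    isCommutativeRing : IsCommutativeRing _≡_ _+_ _*_ -_ 0# 1#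
    0≢1     : ¬ (0# ≡ 1#)
    inverse : ∀ x → ¬ (x ≡ 0#) → Σ Carrier (λ y → x * y ≡ 1#)
    size    : ℕ
    enum    : Carrier ↔ Fin size

module _ (𝔽 : FiniteField) where
  open FiniteField 𝔽

  Vector : ℕ → Set
  Vector n = Fin n → Carrier

  Matrix : ℕ → ℕ → Set
  Matrix r n = Fin r → Fin n → Carrier

  Code : ℕ → Set₁
  Code n = Vector n → Set

  sumF : ∀ {t} → (Fin t → Carrier) → Carrier
  sumF {zero}  f = 0#
  sumF {suc t} f = f fz + sumF (λ i → f (fs i))

  InSpan : ∀ {r n} → Matrix r n → Vector n → Set
  InSpan {r} {n} G v =
    Σ (Fin r → Carrier) λ c → ∀ (j : Fin n) → v j ≡ sumF (λ i → c i * G i j)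

  LinIndep : ∀ {r n} → Matrix r n → Set
  LinIndep {r} {n} G = ∀ (c : Fin r → Carrier) →
    (∀ (j : Fin n) → sumF (λ i → c i * G i j) ≡ 0#) → ∀ i → c i ≡ 0#

  GeneratorMatrix : ∀ {r n} → Matrix r n → Code n → Set
  GeneratorMatrix G C = LinIndep G × (∀ v → C v ⇔ InSpan G v)

  HasDim : ∀ {n} → ℕ → Code n → Set
  HasDim {n} d C = Σ (Matrix d n) λ G → GeneratorMatrix G C

  ProjectiveColumns : ∀ {r n} → Matrix r n → Set
  ProjectiveColumns {r} {n} G =
    (∀ (j : Fin n) → ¬ (∀ (i : Fin r) → G i j ≡ 0#)) ×
    (∀ (j j' : Fin n) → ¬ (j ≡ j') →
       ¬ Σ Carrier (λ a → ∀ (i : Fin r) → G i j ≡ a * G i j'))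

  IsProjCode : ∀ {n} → ℕ → Code n → Set
  IsProjCode {n} k C =
    Σ (Matrix k n) λ G → GeneratorMatrix G C × ProjectiveColumns G

  _≐_ : ∀ {n} → Code n → Code n → Set
  C ≐ D = ∀ v → C v ⇔ D v

  _∩_ : ∀ {n} → Code n → Code n → Code n
  (C ∩ D) v = C v × D v

  -- A clique of Π[n,k]_q: a set of vertices, pairwise adjacent
  -- (distinct codes whose intersection is (k-1)-dimensional).
  -- k is written as suc m, so k-1 = m.
  IsClique : (n m : ℕ) → (Code n → Set₁) → Set₁
  IsClique n m K =
    (∀ C → K C → IsProjCode (suc m) C) ×
    (∀ C D → K C → K D → ¬ (C ≐ D) → HasDim m (C ∩ D))

  IsMaximalClique : (n m : ℕ) → (Code n → Set₁) → Set₂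
  IsMaximalClique n m K =
    IsClique n m K ×
    (∀ (K' : Code n → Set₁) → IsClique n m K' → (∀ C → K C → K' C) →
       ∀ C → K' C → Σ (Code n) λ D → K D × (C ≐ D))

  Star : ∀ {n} → ℕ → Code n → Code n → Set₁
  Star k S C = Lift (Level.suc 0ℓ) (IsProjCode k C × (∀ v → S v → C v))

  δ : ∀ {m n} → Fin m → Fin n → Carrier
  δ i j = if does (toℕ i ≟ toℕ j) then 1# else 0#

  appendRow : ∀ {m n} → Matrix m n → Vector n → Matrix (suc m) n
  appendRow {zero}  M w fz     = w
  appendRow {suc m} M w fz     = M fz
  appendRow {suc m} M w (fs i) = appendRow (λ i' → M (fs i')) w i

  WSet : ∀ {m n} → Matrix m n → Code n
  WSet {m} {n} M w =
    (∀ (j : Fin n) → toℕ j < m → w j ≡ 0#) ×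
    IsProjCode (suc m) (InSpan (appendRow M w))

  SpanOf : ∀ {n} → Code n → Code n
  SpanOf {n} P v =
    Σ ℕ λ t → Σ (Matrix t n) λ ws → (∀ i → P (ws i)) × InSpan ws v

module Submission where

open import Algebra.Bundles using (CommutativeRing; RawRing)
open import Algebra.Solver.Ring.AlmostCommutativeRing using (fromCommutativeRing; _-Raw-AlmostCommutative⟶_)
open import Data.Bool using (if_then_else_)
open import Data.Empty using (⊥-elim)
open import Data.Fin as Fin using (Fin; toℕ; punchIn; inject≤) renaming (zero to fz; suc to fs)
import Data.Fin.Properties as Fin
open import Data.Fin.Permutation.Components using (transpose)
open import Data.Maybe using (Maybe; just; nothing)
open import Data.Nat as ℕ using (ℕ; zero; suc; _≤_; _<_; _∸_; z≤n; s≤s)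
import Data.Nat.Properties as ℕ
open import Data.Product using (Σ; ∃; _×_; _,_; proj₁; proj₂)
import Data.Product.Properties as Product
open import Data.Sum using (_⊎_; inj₁; inj₂)
open import Data.Vec.Functional using (_∷_; insertAt)
open import Data.Vec.Functional.Properties using (insertAt-lookup; insertAt-punchIn)
open import Function using (_∘_)
open import Function.Bundles using (mk⇔; Equivalence; Injection)
open import Function.Construct.Composition using (_⇔-∘_)
open import Function.Construct.Identity using (⇔-id)
open import Function.Construct.Symmetry using (⇔-sym)
open import Function.Properties.Inverse using (↔⇒↣)
import Level
open import Level using (0ℓ; Lift; lift)
open import Relation.Binary.Definitions using (DecidableEquality)
open import Relation.Binary.PropositionalEquality
  using (_≡_; _≗_; refl; sym; trans; cong; cong₂; cong-app; subst; module ≡-Reasoning)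
open import Relation.Nullary using (¬_; Dec; does; yes; no)
open import Relation.Nullary.Decidable using (map′; dec-true; dec-false)
open import Relation.Unary using (Pred; Decidable)

open import Defs

-- Let k = m + 1 and suppose the star [S⟩ of S is a maximal clique.  Reducing a vector of a code
-- C ∈ [S⟩ against the identity block of M leaves a vector w ∈ W with C = ⟨S, w⟩; as ⟨W⟩ is a line, all
-- these w are proportional, so the star consists of a single code E = ⟨G⟩.  Swapping two coordinates
-- keeps a code projective, and if the swapped code D differs from E then E ∩ D is the hyperplane
-- {v ∈ E : v_z = v_c}, so D is adjacent to every member of the star, contradicting maximality.  Hence E
-- is invariant under every transposition (0 c).  A row v of G with v₁ ≠ v₀ then puts e₀ − e₁ into E,
-- and its images e_x − e₁ (x ≠ 1) are n − 1 > k independent vectors of E.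

∀⊎∃¬ : ∀ {n p} {P : Pred (Fin n) p} → Decidable P → (∀ i → P i) ⊎ ∃ λ i → ¬ P i
∀⊎∃¬ P? with Fin.all? P?
... | yes ∀P = inj₁ ∀P
... | no ¬∀P = inj₂ (Fin.¬∀⟶∃¬ _ _ P? ¬∀P)

¬¬-∀ : ∀ {n p} {P : Pred (Fin n) p} → (∀ i → ¬ ¬ P i) → ¬ ¬ (∀ i → P i)
¬¬-∀ {zero}          ¬¬P ¬∀P = ¬∀P λ ()
¬¬-∀ {suc n} {P = P} ¬¬P ¬∀P = ¬¬P fz λ P₀ → ¬¬-∀ {P = P ∘ fs} (¬¬P ∘ fs) λ ∀P → ¬∀P λ where
  fz     → P₀
  (fs i) → ∀P i

module _ {n} (i j : Fin n) where

  transpose-matchˡ : transpose i j i ≡ j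
  transpose-matchˡ rewrite dec-true (i Fin.≟ i) refl = refl

  transpose-matchʳ : transpose i j j ≡ i
  transpose-matchʳ with j Fin.≟ i
  ... | yes j≡i = j≡i
  ... | no _ rewrite dec-true (j Fin.≟ j) refl = refl

  transpose-other : ∀ {k} → ¬ k ≡ i → ¬ k ≡ j → transpose i j k ≡ k
  transpose-other {k} k≢i k≢j rewrite dec-false (k Fin.≟ i) k≢i | dec-false (k Fin.≟ j) k≢j = refl

  transpose-involutive : ∀ k → transpose i j (transpose i j k) ≡ k
  transpose-involutive k = by-cases (k Fin.≟ i) (k Fin.≟ j)
    where
    by-cases : Dec (k ≡ i) → Dec (k ≡ j) → transpose i j (transpose i j k) ≡ k
    by-cases (yes refl) _          = trans (cong (transpose i j) transpose-matchˡ) transpose-matchʳ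
    by-cases (no _)     (yes refl) = trans (cong (transpose i j) transpose-matchʳ) transpose-matchˡ
    by-cases (no k≢i)   (no k≢j)   =
      trans (cong (transpose i j) (transpose-other k≢i k≢j)) (transpose-other k≢i k≢j)

-- The ring solver of the standard library needs coefficients with computable operations: integers are
-- represented by differences a − b of naturals, normalised to (a ∸ b , b ∸ a) so that equal
-- coefficients are identical and normal forms can be compared by refl.
module IntegerCoefficientRingSolver {c ℓ} (R : CommutativeRing c ℓ) where

  private
    open CommutativeRing R renaming (refl to ≈-refl; sym to ≈-sym; trans to ≈-trans)
    open import Algebra.Properties.Ring ring using
      (-‿+-comm; -‿involutive; -‿distribˡ-*; -‿distribʳ-*; ⁻¹-anti-homo‿-; -0#≈0#)
    open import Algebra.Properties.Semiring.Mult semiring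
      using (×-homo-+; ×1-homo-*) renaming (_×_ to _×′_)
    open import Relation.Binary.Reasoning.Setoid setoid

    Diff : Set
    Diff = Σ ℕ λ _ → ℕ

    normalise : ℕ → ℕ → Diff
    normalise a b = a ∸ b , b ∸ a

    integers : RawRing 0ℓ 0ℓ
    integers = record
      { Carrier = Diff
      ; _≈_     = _≡_
      ; _+_     = λ (a , b) (c , d) → normalise (a ℕ.+ c) (b ℕ.+ d)
      ; _*_     = λ (a , b) (c , d) → normalise (a ℕ.* c ℕ.+ b ℕ.* d) (a ℕ.* d ℕ.+ b ℕ.* c)
      ; -_      = λ (a , b) → b , a
      ; 0#      = 0 , 0
      ; 1#      = 1 , 0
      }

    ⟦_⟧ : Diff → Carrier
    ⟦ a , b ⟧ = a ×′ 1# - b ×′ 1#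

    [x+y]-[x+z]≈y-z : ∀ x y z → (x + y) - (x + z) ≈ y - z
    [x+y]-[x+z]≈y-z x y z = begin
      (x + y) + - (x + z)    ≈⟨ +-congˡ (-‿+-comm x z) ⟨
      (x + y) + (- x + - z)  ≈⟨ +-assoc x y _ ⟩
      x + (y + (- x + - z))  ≈⟨ +-congˡ (+-assoc y _ _) ⟨
      x + ((y + - x) + - z)  ≈⟨ +-congˡ (+-congʳ (+-comm y (- x))) ⟩
      x + ((- x + y) + - z)  ≈⟨ +-congˡ (+-assoc _ _ _) ⟩
      x + (- x + (y + - z))  ≈⟨ +-assoc _ _ _ ⟨
      (x + - x) + (y - z)    ≈⟨ +-congʳ (-‿inverseʳ x) ⟩
      0# + (y - z)           ≈⟨ +-identityˡ _ ⟩
      y - z                  ∎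

    [a+c]-[b+d]≈[a-b]+[c-d] : ∀ a b c d → (a + c) - (b + d) ≈ (a - b) + (c - d)
    [a+c]-[b+d]≈[a-b]+[c-d] a b c d = begin
      (a + c) + - (b + d)    ≈⟨ +-congˡ (-‿+-comm b d) ⟨
      (a + c) + (- b + - d)  ≈⟨ +-assoc a c _ ⟩
      a + (c + (- b + - d))  ≈⟨ +-congˡ (+-assoc c _ _) ⟨
      a + ((c + - b) + - d)  ≈⟨ +-congˡ (+-congʳ (+-comm c (- b))) ⟩
      a + ((- b + c) + - d)  ≈⟨ +-congˡ (+-assoc _ _ _) ⟩
      a + (- b + (c + - d))  ≈⟨ +-assoc _ _ _ ⟨
      (a - b) + (c - d)      ∎

    [a-b][c-d]≈[ac+bd]-[ad+bc] : ∀ a b c d → (a - b) * (c - d) ≈ (a * c + b * d) - (a * d + b * c)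
    [a-b][c-d]≈[ac+bd]-[ad+bc] a b c d = begin
      (a + - b) * (c + - d)                      ≈⟨ distribʳ _ _ _ ⟩
      a * (c + - d) + - b * (c + - d)            ≈⟨ +-cong (distribˡ _ _ _) (distribˡ _ _ _) ⟩
      (a * c + a * - d) + (- b * c + - b * - d)  ≈⟨ +-cong (+-congˡ (-‿distribʳ-* a d))
                                                            (+-cong (-‿distribˡ-* b c) bd≈-b*-d) ⟨
      (a * c - a * d) + (- (b * c) + b * d)      ≈⟨ +-congˡ (+-comm _ _) ⟩
      (a * c - a * d) + (b * d - b * c)          ≈⟨ [a+c]-[b+d]≈[a-b]+[c-d] _ _ _ _ ⟨
      (a * c + b * d) - (a * d + b * c)          ∎
      where
      bd≈-b*-d : b * d ≈ - b * - d
      bd≈-b*-d = begin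
        b * d        ≈⟨ -‿involutive _ ⟨
        - - (b * d)  ≈⟨ -‿cong (-‿distribʳ-* b d) ⟩
        - (b * - d)  ≈⟨ -‿distribˡ-* b (- d) ⟩
        - b * - d    ∎

    -‿cong₂ : ∀ {x x′ y y′} → x ≈ x′ → y ≈ y′ → x - y ≈ x′ - y′
    -‿cong₂ x≈x′ y≈y′ = +-cong x≈x′ (-‿cong y≈y′)

    ⟦normalise⟧ : ∀ a b → ⟦ normalise a b ⟧ ≈ ⟦ a , b ⟧
    ⟦normalise⟧ zero    zero    = ≈-refl
    ⟦normalise⟧ zero    (suc b) = ≈-refl
    ⟦normalise⟧ (suc a) zero    = ≈-refl
    ⟦normalise⟧ (suc a) (suc b) =
      ≈-trans (⟦normalise⟧ a b) (≈-sym ([x+y]-[x+z]≈y-z 1# (a ×′ 1#) (b ×′ 1#)))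

    ×1-homo-*+ : ∀ a c b d → (a ℕ.* c ℕ.+ b ℕ.* d) ×′ 1# ≈ (a ×′ 1#) * (c ×′ 1#) + (b ×′ 1#) * (d ×′ 1#)
    ×1-homo-*+ a c b d = ≈-trans (×-homo-+ 1# (a ℕ.* c) (b ℕ.* d)) (+-cong (×1-homo-* a c) (×1-homo-* b d))

    homomorphism : integers -Raw-AlmostCommutative⟶ fromCommutativeRing R
    homomorphism = record
      { ⟦_⟧    = ⟦_⟧
      ; +-homo = λ (a , b) (c , d) → ≈-trans (⟦normalise⟧ (a ℕ.+ c) (b ℕ.+ d))
          (≈-trans (-‿cong₂ (×-homo-+ 1# a c) (×-homo-+ 1# b d)) ([a+c]-[b+d]≈[a-b]+[c-d] _ _ _ _))
      ; *-homo = λ (a , b) (c , d) → ≈-trans (⟦normalise⟧ (a ℕ.* c ℕ.+ b ℕ.* d) (a ℕ.* d ℕ.+ b ℕ.* c))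
          (≈-trans (-‿cong₂ (×1-homo-*+ a c b d) (×1-homo-*+ a d b c))
                   (≈-sym ([a-b][c-d]≈[ac+bd]-[ad+bc] _ _ _ _)))
      ; -‿homo = λ (a , b) → ≈-sym (⁻¹-anti-homo‿- (a ×′ 1#) (b ×′ 1#))
      ; 0-homo = -‿inverseʳ 0#
      ; 1-homo = ≈-trans (+-cong (+-identityʳ 1#) -0#≈0#) (+-identityʳ 1#)
      }

    _≟_ : ∀ p q → Maybe (⟦ p ⟧ ≈ ⟦ q ⟧)
    p ≟ q with Product.≡-dec ℕ._≟_ ℕ._≟_ p q
    ... | yes refl = just ≈-refl
    ... | no _     = nothing

  open import Algebra.Solver.Ring integers (fromCommutativeRing R) homomorphism _≟_ public

module _ (𝔽 : FiniteField) where
  open FiniteField 𝔽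

  commutativeRing : CommutativeRing 0ℓ 0ℓ
  commutativeRing = record { isCommutativeRing = isCommutativeRing }

  open CommutativeRing commutativeRing using
    ( _-_; *-comm; *-assoc; distribˡ; zeroˡ; zeroʳ
    ; +-identityˡ; +-identityʳ; *-identityˡ; *-identityʳ; -‿inverseʳ)
  open import Algebra.Properties.Ring (CommutativeRing.ring commutativeRing) using
    ( -0#≈0#; -‿+-comm; -‿distribˡ-*; -‿distribʳ-*; ⁻¹-anti-homo‿-; +-inverseˡ-unique
    ; x∙y⁻¹≈ε⇒x≈y; x≈y⇒x∙y⁻¹≈ε)
  open IntegerCoefficientRingSolver commutativeRing using (solve; _:=_; _:+_; _:-_; _:*_; :-_)

  _≟_ : DecidableEquality Carrier
  x ≟ y = map′ (Injection.injective enum↣) (cong (Injection.to enum↣))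
               (Injection.to enum↣ x Fin.≟ Injection.to enum↣ y)
    where enum↣ = ↔⇒↣ enum

  vector-zero⊎nonzero : ∀ {n} (v : Vector 𝔽 n) → (∀ j → v j ≡ 0#) ⊎ ∃ λ j → ¬ v j ≡ 0#
  vector-zero⊎nonzero v = ∀⊎∃¬ (λ j → v j ≟ 0#)

  matrix-zero⊎nonzero : ∀ {r n} (A : Matrix 𝔽 r n) →
                        (∀ i j → A i j ≡ 0#) ⊎ ∃ λ i → ∃ λ j → ¬ A i j ≡ 0#
  matrix-zero⊎nonzero A with ∀⊎∃¬ (λ i → Fin.all? (λ j → A i j ≟ 0#))
  ... | inj₁ A≡0         = inj₁ A≡0
  ... | inj₂ (i , ¬Ai≡0) = inj₂ (i , Fin.¬∀⟶∃¬ _ _ (λ j → A i j ≟ 0#) ¬Ai≡0)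

  1≢0 : ¬ 1# ≡ 0#
  1≢0 = 0≢1 ∘ sym

  x≢y⇒x-y≢0 : ∀ {x y} → ¬ x ≡ y → ¬ x - y ≡ 0#
  x≢y⇒x-y≢0 x≢y = x≢y ∘ x∙y⁻¹≈ε⇒x≈y _ _

  _⁻¹⟨_⟩ : (x : Carrier) → ¬ x ≡ 0# → Carrier
  x ⁻¹⟨ x≢0 ⟩ = proj₁ (inverse x x≢0)

  x⁻¹*x≡1 : ∀ x (x≢0 : ¬ x ≡ 0#) → x ⁻¹⟨ x≢0 ⟩ * x ≡ 1#
  x⁻¹*x≡1 x x≢0 = trans (*-comm _ x) (proj₂ (inverse x x≢0))

  y*x⁻¹*x≡y : ∀ y {x} (x≢0 : ¬ x ≡ 0#) → y * x ⁻¹⟨ x≢0 ⟩ * x ≡ y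
  y*x⁻¹*x≡y y {x} x≢0 = trans (*-assoc y _ x) (trans (cong (y *_) (x⁻¹*x≡1 x x≢0)) (*-identityʳ y))

  xy≡0⇒y≡0 : ∀ {x y} → ¬ x ≡ 0# → x * y ≡ 0# → y ≡ 0#
  xy≡0⇒y≡0 {x} {y} x≢0 xy≡0 = begin
    y                      ≡⟨ *-identityˡ y ⟨
    1# * y                 ≡⟨ cong (_* y) (x⁻¹*x≡1 x x≢0) ⟨
    x ⁻¹⟨ x≢0 ⟩ * x * y    ≡⟨ *-assoc _ x y ⟩
    x ⁻¹⟨ x≢0 ⟩ * (x * y)  ≡⟨ cong (x ⁻¹⟨ x≢0 ⟩ *_) xy≡0 ⟩
    x ⁻¹⟨ x≢0 ⟩ * 0#       ≡⟨ zeroʳ _ ⟩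
    0#                     ∎
    where open ≡-Reasoning

  x-0#≡x : ∀ x → x - 0# ≡ x
  x-0#≡x x = trans (cong (x +_) -0#≈0#) (+-identityʳ x)

  1*x+-r*y≡x-r*y : ∀ x r y → 1# * x + - r * y ≡ x - r * y
  1*x+-r*y≡x-r*y x r y = cong₂ _+_ (*-identityˡ x) (sym (-‿distribˡ-* r y))

  δ-refl : ∀ {t} (i : Fin t) → δ 𝔽 i i ≡ 1#
  δ-refl i = cong (if_then 1# else 0#) (dec-true (toℕ i ℕ.≟ toℕ i) refl)

  δ-toℕ-≢ : ∀ {s t} {i : Fin s} {j : Fin t} → ¬ toℕ i ≡ toℕ j → δ 𝔽 i j ≡ 0#
  δ-toℕ-≢ {i = i} {j} i≢j = cong (if_then 1# else 0#) (dec-false (toℕ i ℕ.≟ toℕ j) i≢j)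

  δ-≢ : ∀ {t} {i j : Fin t} → ¬ i ≡ j → δ 𝔽 i j ≡ 0#
  δ-≢ i≢j = δ-toℕ-≢ (i≢j ∘ Fin.toℕ-injective)

  δ-congʳ : ∀ {s t u} (i : Fin s) {j : Fin t} {k : Fin u} → toℕ j ≡ toℕ k → δ 𝔽 i j ≡ δ 𝔽 i k
  δ-congʳ i = cong (λ x → if does (toℕ i ℕ.≟ x) then 1# else 0#)

  δ-sym : ∀ {t} (i j : Fin t) → δ 𝔽 i j ≡ δ 𝔽 j i
  δ-sym i j with i Fin.≟ j
  ... | yes refl = refl
  ... | no i≢j   = trans (δ-≢ i≢j) (sym (δ-≢ (i≢j ∘ sym)))

  δ-punchIn : ∀ {n} (b : Fin (suc n)) (i i₀ : Fin n) → δ 𝔽 (punchIn b i) (punchIn b i₀) ≡ δ 𝔽 i₀ i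
  δ-punchIn b i i₀ with i Fin.≟ i₀
  ... | yes refl = trans (δ-refl (punchIn b i)) (sym (δ-refl i))
  ... | no i≢i₀  =
    trans (δ-≢ {i = punchIn b i} (i≢i₀ ∘ Fin.punchIn-injective b i i₀)) (sym (δ-≢ (i≢i₀ ∘ sym)))

  δ-transpose : ∀ {n} (a b k j : Fin n) → δ 𝔽 k (transpose a b j) ≡ δ 𝔽 (transpose a b k) j
  δ-transpose a b k j with k Fin.≟ transpose a b j
  ... | yes refl = trans (δ-refl (transpose a b j))
                         (sym (trans (cong (λ x → δ 𝔽 x j) (transpose-involutive a b j)) (δ-refl j)))
  ... | no k≢τj  = trans (δ-≢ k≢τj) (sym (δ-≢ {i = transpose a b k} (k≢τj ∘ τk≡j⇒k≡τj)))
    where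
    τk≡j⇒k≡τj : transpose a b k ≡ j → k ≡ transpose a b j
    τk≡j⇒k≡τj τk≡j = trans (sym (transpose-involutive a b k)) (cong (transpose a b) τk≡j)

  sumF-cong : ∀ {t} {f g : Fin t → Carrier} → (∀ i → f i ≡ g i) → sumF 𝔽 f ≡ sumF 𝔽 g
  sumF-cong {zero}  f≗g = refl
  sumF-cong {suc t} f≗g = cong₂ _+_ (f≗g fz) (sumF-cong (f≗g ∘ fs))

  sumF-zero : ∀ {t} {f : Fin t → Carrier} → (∀ i → f i ≡ 0#) → sumF 𝔽 f ≡ 0#
  sumF-zero {zero}  f≗0 = refl
  sumF-zero {suc t} f≗0 = trans (cong₂ _+_ (f≗0 fz) (sumF-zero (f≗0 ∘ fs))) (+-identityˡ 0#)

  sumF-+ : ∀ {t} (f g : Fin t → Carrier) → sumF 𝔽 (λ i → f i + g i) ≡ sumF 𝔽 f + sumF 𝔽 g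
  sumF-+ {zero}  f g = sym (+-identityˡ 0#)
  sumF-+ {suc t} f g = trans (cong (f fz + g fz +_) (sumF-+ (f ∘ fs) (g ∘ fs)))
    (solve 4 (λ a b c d → (a :+ b) :+ (c :+ d) := (a :+ c) :+ (b :+ d)) refl (f fz) (g fz) _ _)

  *-distribˡ-sumF : ∀ {t} a (f : Fin t → Carrier) → a * sumF 𝔽 f ≡ sumF 𝔽 (λ i → a * f i)
  *-distribˡ-sumF {zero}  a f = zeroʳ a
  *-distribˡ-sumF {suc t} a f =
    trans (distribˡ a (f fz) _) (cong (a * f fz +_) (*-distribˡ-sumF a (f ∘ fs)))

  *-distribʳ-sumF : ∀ {t} a (f : Fin t → Carrier) → sumF 𝔽 f * a ≡ sumF 𝔽 (λ i → f i * a)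
  *-distribʳ-sumF a f =
    trans (*-comm _ a) (trans (*-distribˡ-sumF a f) (sumF-cong λ i → *-comm a (f i)))

  -‿sumF : ∀ {t} (f : Fin t → Carrier) → - sumF 𝔽 f ≡ sumF 𝔽 (λ i → - f i)
  -‿sumF {zero}  f = -0#≈0#
  -‿sumF {suc t} f = trans (sym (-‿+-comm (f fz) _)) (cong (- f fz +_) (-‿sumF (f ∘ fs)))

  sumF-comm : ∀ {s t} (f : Fin s → Fin t → Carrier) →
              sumF 𝔽 (λ i → sumF 𝔽 (f i)) ≡ sumF 𝔽 (λ j → sumF 𝔽 (λ i → f i j))
  sumF-comm {zero}  {t} f = sym (sumF-zero {t} λ _ → refl)
  sumF-comm {suc s}     f = trans (cong (sumF 𝔽 (f fz) +_) (sumF-comm (f ∘ fs)))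
                                  (sym (sumF-+ (f fz) (λ j → sumF 𝔽 (λ i → f (fs i) j))))

  sumF-punchIn : ∀ {t} (p : Fin (suc t)) (f : Fin (suc t) → Carrier) →
                 sumF 𝔽 f ≡ f p + sumF 𝔽 (f ∘ punchIn p)
  sumF-punchIn         fz     f = refl
  sumF-punchIn {suc t} (fs p) f = trans (cong (f fz +_) (sumF-punchIn p (f ∘ fs)))
    (solve 3 (λ a b c → a :+ (b :+ c) := b :+ (a :+ c)) refl (f fz) (f (fs p)) _)

  sumF-δ : ∀ {t} (p : Fin t) (f : Fin t → Carrier) → sumF 𝔽 (λ i → δ 𝔽 p i * f i) ≡ f p
  sumF-δ {suc t} p f = begin
    sumF 𝔽 (λ i → δ 𝔽 p i * f i)
      ≡⟨ sumF-punchIn p (λ i → δ 𝔽 p i * f i) ⟩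
    δ 𝔽 p p * f p + sumF 𝔽 (λ i → δ 𝔽 p (punchIn p i) * f (punchIn p i))
      ≡⟨ cong₂ _+_ (cong (_* f p) (δ-refl p)) (sumF-zero off-diagonal) ⟩
    1# * f p + 0#
      ≡⟨ trans (+-identityʳ _) (*-identityˡ _) ⟩
    f p
      ∎
    where
    open ≡-Reasoning
    off-diagonal : ∀ i → δ 𝔽 p (punchIn p i) * f (punchIn p i) ≡ 0#
    off-diagonal i = trans (cong (_* f (punchIn p i)) (δ-≢ (Fin.punchInᵢ≢i p i ∘ sym))) (zeroˡ _)

  infix 7 _∙_
  _∙_ : ∀ {t} → (Fin t → Carrier) → (Fin t → Carrier) → Carrier
  c ∙ f = sumF 𝔽 (λ i → c i * f i)

  ∙-sub : ∀ {t} (a f g : Fin t → Carrier) → a ∙ f - a ∙ g ≡ a ∙ (λ i → f i - g i)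
  ∙-sub a f g = begin
    a ∙ f - a ∙ g                             ≡⟨ cong (a ∙ f +_) (-‿sumF (λ i → a i * g i)) ⟩
    a ∙ f + sumF 𝔽 (λ i → - (a i * g i))      ≡⟨ sumF-+ (λ i → a i * f i) (λ i → - (a i * g i)) ⟨
    sumF 𝔽 (λ i → a i * f i + - (a i * g i))  ≡⟨ sumF-cong (λ i → distrib (a i) (f i) (g i)) ⟩
    a ∙ (λ i → f i - g i)                     ∎
    where
    open ≡-Reasoning
    distrib : ∀ a f g → a * f + - (a * g) ≡ a * (f - g)
    distrib = solve 3 (λ a f g → a :* f :- a :* g := a :* (f :- g)) refl

  lincomb : ∀ {r n} → (Fin r → Carrier) → Matrix 𝔽 r n → Vector 𝔽 n
  lincomb c G j = c ∙ (λ i → G i j)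

  lincomb-cong : ∀ {r n} {c d : Fin r → Carrier} (G : Matrix 𝔽 r n) → c ≗ d →
                 ∀ j → lincomb c G j ≡ lincomb d G j
  lincomb-cong G c≗d j = sumF-cong λ i → cong (_* G i j) (c≗d i)

  lincomb-linear : ∀ {r n} a b (c d : Fin r → Carrier) (G : Matrix 𝔽 r n) j →
                   a * lincomb c G j + b * lincomb d G j ≡ lincomb (λ i → a * c i + b * d i) G j
  lincomb-linear a b c d G j = begin
    a * lincomb c G j + b * lincomb d G j
      ≡⟨ cong₂ _+_ (*-distribˡ-sumF a (λ i → c i * G i j)) (*-distribˡ-sumF b (λ i → d i * G i j)) ⟩
    sumF 𝔽 (λ i → a * (c i * G i j)) + sumF 𝔽 (λ i → b * (d i * G i j))
      ≡⟨ sumF-+ (λ i → a * (c i * G i j)) (λ i → b * (d i * G i j)) ⟨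
    sumF 𝔽 (λ i → a * (c i * G i j) + b * (d i * G i j))
      ≡⟨ sumF-cong (λ i → solve 5 (λ a b c d g → a :* (c :* g) :+ b :* (d :* g) := (a :* c :+ b :* d) :* g)
                                   refl a b (c i) (d i) (G i j)) ⟩
    lincomb (λ i → a * c i + b * d i) G j
      ∎
    where open ≡-Reasoning

  lincomb-assoc : ∀ {r s n} (c : Fin s → Carrier) (μ : Matrix 𝔽 s r) (G : Matrix 𝔽 r n) j →
                  lincomb c (λ i → lincomb (μ i) G) j ≡ lincomb (lincomb c μ) G j
  lincomb-assoc c μ G j = begin
    sumF 𝔽 (λ i → c i * sumF 𝔽 (λ l → μ i l * G l j))
      ≡⟨ sumF-cong (λ i → *-distribˡ-sumF (c i) (λ l → μ i l * G l j)) ⟩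
    sumF 𝔽 (λ i → sumF 𝔽 (λ l → c i * (μ i l * G l j)))
      ≡⟨ sumF-comm (λ i l → c i * (μ i l * G l j)) ⟩
    sumF 𝔽 (λ l → sumF 𝔽 (λ i → c i * (μ i l * G l j)))
      ≡⟨ sumF-cong (λ l → sumF-cong λ i → *-assoc (c i) (μ i l) (G l j)) ⟨
    sumF 𝔽 (λ l → sumF 𝔽 (λ i → c i * μ i l * G l j))
      ≡⟨ sumF-cong (λ l → *-distribʳ-sumF (G l j) (λ i → c i * μ i l)) ⟨
    sumF 𝔽 (λ l → lincomb c μ l * G l j)
      ∎
    where open ≡-Reasoning

  lincomb-punchIn : ∀ {r n} (p : Fin (suc r)) (c : Fin (suc r) → Carrier) (G : Matrix 𝔽 (suc r) n) j →
                    lincomb c G j ≡ c p * G p j + lincomb (c ∘ punchIn p) (G ∘ punchIn p) j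
  lincomb-punchIn p c G j = sumF-punchIn p (λ i → c i * G i j)

  lincomb-tail : ∀ {r n} (c : Fin (suc r) → Carrier) (G : Matrix 𝔽 (suc r) n) → c fz ≡ 0# →
                 ∀ j → lincomb c G j ≡ lincomb (c ∘ fs) (G ∘ fs) j
  lincomb-tail c G c₀≡0 j =
    trans (cong (λ x → x * G fz j + rest) c₀≡0) (trans (cong (_+ rest) (zeroˡ _)) (+-identityˡ _))
    where rest = lincomb (c ∘ fs) (G ∘ fs) j

  InSpan-resp : ∀ {r n} (G : Matrix 𝔽 r n) {u v} → u ≗ v → InSpan 𝔽 G u → InSpan 𝔽 G v
  InSpan-resp G u≗v (c , u≡cG) = c , λ j → trans (sym (u≗v j)) (u≡cG j)

  InSpan-row : ∀ {r n} (G : Matrix 𝔽 r n) p → InSpan 𝔽 G (G p)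
  InSpan-row G p = δ 𝔽 p , λ j → sym (sumF-δ p (λ i → G i j))

  InSpan-combine : ∀ {r n} (G : Matrix 𝔽 r n) {u v} a b →
                   InSpan 𝔽 G u → InSpan 𝔽 G v → InSpan 𝔽 G (λ j → a * u j + b * v j)
  InSpan-combine G a b (c , u≡cG) (d , v≡dG) = (λ i → a * c i + b * d i) , λ j →
    trans (cong₂ (λ x y → a * x + b * y) (u≡cG j) (v≡dG j)) (lincomb-linear a b c d G j)

  InSpan-sub : ∀ {r n} (G : Matrix 𝔽 r n) {u v} a →
               InSpan 𝔽 G u → InSpan 𝔽 G v → InSpan 𝔽 G (λ j → u j - a * v j)
  InSpan-sub G a u∈G v∈G = InSpan-resp G (λ j → 1*x+-r*y≡x-r*y _ a _) (InSpan-combine G 1# (- a) u∈G v∈G)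

  InSpan-scale : ∀ {r n} (G : Matrix 𝔽 r n) {u} s → InSpan 𝔽 G u → InSpan 𝔽 G (λ j → s * u j)
  InSpan-scale G s (c , u≡cG) = (λ i → s * c i) , λ j → trans (cong (s *_) (u≡cG j))
    (trans (*-distribˡ-sumF s (λ i → c i * G i j)) (sumF-cong λ i → sym (*-assoc s (c i) (G i j))))

  InSpan-trans : ∀ {r s n} (G : Matrix 𝔽 r n) {H : Matrix 𝔽 s n} →
                 (∀ i → InSpan 𝔽 G (H i)) → ∀ {v} → InSpan 𝔽 H v → InSpan 𝔽 G v
  InSpan-trans G H⊆G (c , v≡cH) = lincomb c (proj₁ ∘ H⊆G) , λ j → trans (v≡cH j)
    (trans (sumF-cong λ i → cong (c i *_) (proj₂ (H⊆G i) j)) (lincomb-assoc c (proj₁ ∘ H⊆G) G j))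

  InSpan-tail : ∀ {s n} (H : Matrix 𝔽 (suc s) n) {u} (u∈H : InSpan 𝔽 H u) →
                proj₁ u∈H fz ≡ 0# → InSpan 𝔽 (H ∘ fs) u
  InSpan-tail H (c , u≡cH) c₀≡0 = c ∘ fs , λ j → trans (u≡cH j) (lincomb-tail c H c₀≡0 j)

  InSpan-∷ : ∀ {r n} (G : Matrix 𝔽 r n) w {v} → InSpan 𝔽 G v → InSpan 𝔽 (w ∷ G) v
  InSpan-∷ G w (c , v≡cG) = (0# ∷ c) , λ j → trans (v≡cG j) (sym (lincomb-tail (0# ∷ c) (w ∷ G) refl j))

  InSpan-∷-scaled : ∀ {r n} (G : Matrix 𝔽 r n) {w w′} s → (∀ j → w′ j ≡ s * w j) →
                    ∀ {v} → InSpan 𝔽 (w′ ∷ G) v → InSpan 𝔽 (w ∷ G) v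
  InSpan-∷-scaled G {w} {w′} s w′≡sw = InSpan-trans (w ∷ G) {H = w′ ∷ G} λ where
    fz     → InSpan-resp (w ∷ G) (sym ∘ w′≡sw) (InSpan-scale (w ∷ G) s (InSpan-row (w ∷ G) fz))
    (fs i) → InSpan-row (w ∷ G) (fs i)

  InSpan-difference : ∀ {r n} (G : Matrix 𝔽 r n) {v : Vector 𝔽 n} a → (∀ j → v j ≡ lincomb a G j) →
                      ∀ z c → v z - v c ≡ a ∙ (λ i → G i z - G i c)
  InSpan-difference G a v≡aG z c = trans (cong₂ _-_ (v≡aG z) (v≡aG c)) (∙-sub a (λ i → G i z) (λ i → G i c))

  InSpan-balanced : ∀ {r n} (G : Matrix 𝔽 r n) z c → (∀ i → G i z ≡ G i c) →
                    ∀ {v} → InSpan 𝔽 G v → v z ≡ v c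
  InSpan-balanced G z c G-balanced {v} (a , v≡aG) = x∙y⁻¹≈ε⇒x≈y (v z) (v c)
    (trans (InSpan-difference G {v} a v≡aG z c)
           (sumF-zero λ i → trans (cong (a i *_) (column-difference≡0 i)) (zeroʳ _)))
    where
    column-difference≡0 : ∀ i → G i z - G i c ≡ 0#
    column-difference≡0 i = x≈y⇒x∙y⁻¹≈ε (G-balanced i)

  ≐-refl : ∀ {n} {C : Code 𝔽 n} → _≐_ 𝔽 C C
  ≐-refl _ = ⇔-id _

  ≐-sym : ∀ {n} {C D : Code 𝔽 n} → _≐_ 𝔽 C D → _≐_ 𝔽 D C
  ≐-sym C≐D v = ⇔-sym (C≐D v)

  ≐-trans : ∀ {n} {C D E : Code 𝔽 n} → _≐_ 𝔽 C D → _≐_ 𝔽 D E → _≐_ 𝔽 C E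
  ≐-trans C≐D D≐E v = D≐E v ⇔-∘ C≐D v

  HasDim-resp : ∀ {n d} {C D : Code 𝔽 n} → _≐_ 𝔽 C D → HasDim 𝔽 d C → HasDim 𝔽 d D
  HasDim-resp C≐D (G , G-indep , C≐⟨G⟩) = G , G-indep , ≐-trans (≐-sym C≐D) C≐⟨G⟩

  IsProjCode-resp : ∀ {n d} {C D : Code 𝔽 n} → _≐_ 𝔽 C D → IsProjCode 𝔽 d C → IsProjCode 𝔽 d D
  IsProjCode-resp C≐D (G , (G-indep , C≐⟨G⟩) , G-proj) = G , (G-indep , ≐-trans (≐-sym C≐D) C≐⟨G⟩) , G-proj

  ∩-resp : ∀ {n} {C C′ D D′ : Code 𝔽 n} → _≐_ 𝔽 C C′ → _≐_ 𝔽 D D′ → _≐_ 𝔽 (_∩_ 𝔽 C D) (_∩_ 𝔽 C′ D′)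
  ∩-resp C≐C′ D≐D′ v = mk⇔ (λ (x , y) → Equivalence.to (C≐C′ v) x , Equivalence.to (D≐D′ v) y)
                          (λ (x , y) → Equivalence.from (C≐C′ v) x , Equivalence.from (D≐D′ v) y)

  ∩-comm : ∀ {n} (C D : Code 𝔽 n) → _≐_ 𝔽 (_∩_ 𝔽 C D) (_∩_ 𝔽 D C)
  ∩-comm C D v = mk⇔ (λ (x , y) → y , x) (λ (x , y) → y , x)

  -- Row elimination and the exchange lemma

  eliminate : ∀ {t n} → Matrix 𝔽 (suc t) n → Fin (suc t) → (Fin t → Carrier) → Matrix 𝔽 t n
  eliminate G p r i j = G (punchIn p i) j - r i * G p j

  lincomb-eliminate : ∀ {t n} (a : Fin t → Carrier) (G : Matrix 𝔽 (suc t) n) p r j →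
                      lincomb a (eliminate G p r) j ≡ lincomb a (G ∘ punchIn p) j - (a ∙ r) * G p j
  lincomb-eliminate a G p r j = begin
    sumF 𝔽 (λ i → a i * (G (punchIn p i) j - r i * G p j))
      ≡⟨ sumF-cong (λ i → solve 4 (λ a g r h → a :* (g :- r :* h) := a :* g :+ (:- h) :* (a :* r))
                                   refl (a i) (G (punchIn p i) j) (r i) (G p j)) ⟩
    sumF 𝔽 (λ i → a i * G (punchIn p i) j + (- G p j) * (a i * r i))
      ≡⟨ sumF-+ (λ i → a i * G (punchIn p i) j) (λ i → (- G p j) * (a i * r i)) ⟩
    lincomb a (G ∘ punchIn p) j + sumF 𝔽 (λ i → (- G p j) * (a i * r i))
      ≡⟨ cong (lincomb a (G ∘ punchIn p) j +_) (*-distribˡ-sumF (- G p j) (λ i → a i * r i)) ⟨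
    lincomb a (G ∘ punchIn p) j + (- G p j) * (a ∙ r)
      ≡⟨ solve 3 (λ x h s → x :+ (:- h) :* s := x :- s :* h) refl _ (G p j) (a ∙ r) ⟩
    lincomb a (G ∘ punchIn p) j - (a ∙ r) * G p j
      ∎
    where open ≡-Reasoning

  LinIndep-eliminate : ∀ {t n} (G : Matrix 𝔽 (suc t) n) → LinIndep 𝔽 G → ∀ p r → LinIndep 𝔽 (eliminate G p r)
  LinIndep-eliminate G G-indep p r a a·E≡0 i =
    trans (sym (insertAt-punchIn a p κ i)) (G-indep (insertAt a p κ) c·G≡0 (punchIn p i))
    where
    open ≡-Reasoning
    κ = - (a ∙ r)
    c·G≡0 : ∀ j → lincomb (insertAt a p κ) G j ≡ 0#
    c·G≡0 j = begin
      lincomb (insertAt a p κ) G j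
        ≡⟨ lincomb-punchIn p (insertAt a p κ) G j ⟩
      insertAt a p κ p * G p j + lincomb (insertAt a p κ ∘ punchIn p) (G ∘ punchIn p) j
        ≡⟨ cong₂ (λ x y → x * G p j + y) (insertAt-lookup a p κ)
                 (lincomb-cong (G ∘ punchIn p) (insertAt-punchIn a p κ) j) ⟩
      κ * G p j + lincomb a (G ∘ punchIn p) j
        ≡⟨ solve 3 (λ s h x → (:- s) :* h :+ x := x :- s :* h) refl (a ∙ r) (G p j) _ ⟩
      lincomb a (G ∘ punchIn p) j - (a ∙ r) * G p j
        ≡⟨ lincomb-eliminate a G p r j ⟨
      lincomb a (eliminate G p r) j
        ≡⟨ a·E≡0 j ⟩
      0#
        ∎

  -- Steinitz exchange: pivot on a vector whose first coordinate with respect to H is nonzero, eliminate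
  -- it from the others, and recurse with the first row of H dropped.
  LinIndep⇒≤ : ∀ s {t n} (H : Matrix 𝔽 s n) (v : Matrix 𝔽 t n) →
               LinIndep 𝔽 v → (∀ a → InSpan 𝔽 H (v a)) → t ≤ s
  LinIndep⇒≤ _ {zero} _ _ _ _ = z≤n
  LinIndep⇒≤ zero {suc t} H v v-indep v⊆H = ⊥-elim (1≢0 (v-indep (λ _ → 1#) 1·v≡0 fz))
    where
    1·v≡0 : ∀ j → lincomb (λ _ → 1#) v j ≡ 0#
    1·v≡0 j = sumF-zero λ a → trans (cong (1# *_) (proj₂ (v⊆H a) j)) (zeroʳ 1#)
  LinIndep⇒≤ (suc s) {suc t} H v v-indep v⊆H with ∀⊎∃¬ (λ a → proj₁ (v⊆H a) fz ≟ 0#)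
  ... | inj₁ heads≡0 =
    ℕ.m≤n⇒m≤1+n (LinIndep⇒≤ s (H ∘ fs) v v-indep λ a → InSpan-tail H (v⊆H a) (heads≡0 a))
  ... | inj₂ (a₀ , π≢0) =
    s≤s (LinIndep⇒≤ s (H ∘ fs) (eliminate v a₀ r) (LinIndep-eliminate v v-indep a₀ r)
                    λ a → InSpan-tail H (eliminated∈H a) (head≡0 a))
    where
    head : Fin (suc t) → Carrier
    head a = proj₁ (v⊆H a) fz
    r : Fin t → Carrier
    r a = head (punchIn a₀ a) * head a₀ ⁻¹⟨ π≢0 ⟩
    eliminated∈H : ∀ a → InSpan 𝔽 H (eliminate v a₀ r a)
    eliminated∈H a = InSpan-sub H (r a) (v⊆H (punchIn a₀ a)) (v⊆H a₀)
    head≡0 : ∀ a → proj₁ (eliminated∈H a) fz ≡ 0#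
    head≡0 a = trans (1*x+-r*y≡x-r*y _ (r a) _)
                     (trans (cong (λ x → head (punchIn a₀ a) - x) (y*x⁻¹*x≡y _ π≢0)) (-‿inverseʳ _))

  Hyperplane : ∀ {r n} → Matrix 𝔽 r n → Fin n → Fin n → Code 𝔽 n
  Hyperplane G z c v = InSpan 𝔽 G v × v z ≡ v c

  Hyperplane-HasDim : ∀ {m n} (G : Matrix 𝔽 (suc m) n) → LinIndep 𝔽 G →
                      ∀ z c p → ¬ G p z ≡ G p c → HasDim 𝔽 m (Hyperplane G z c)
  Hyperplane-HasDim G G-indep z c p Gpz≢Gpc = B , LinIndep-eliminate G G-indep p r , λ v → mk⇔ H⊆B B⊆H
    where
    open ≡-Reasoning
    f : Fin _ → Carrier
    f i = G i z - G i c
    fp≢0 : ¬ f p ≡ 0#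
    fp≢0 = x≢y⇒x-y≢0 Gpz≢Gpc
    r : Fin _ → Carrier
    r i = f (punchIn p i) * f p ⁻¹⟨ fp≢0 ⟩
    B = eliminate G p r

    B-balanced : ∀ i → B i z ≡ B i c
    B-balanced i = x∙y⁻¹≈ε⇒x≈y _ _ (begin
      (G (punchIn p i) z - r i * G p z) - (G (punchIn p i) c - r i * G p c)
        ≡⟨ solve 5 (λ gz gc r hz hc → (gz :- r :* hz) :- (gc :- r :* hc) := (gz :- gc) :- r :* (hz :- hc))
                   refl (G (punchIn p i) z) (G (punchIn p i) c) (r i) (G p z) (G p c) ⟩
      f (punchIn p i) - r i * f p        ≡⟨ cong (λ x → f (punchIn p i) - x) (y*x⁻¹*x≡y _ fp≢0) ⟩
      f (punchIn p i) - f (punchIn p i)  ≡⟨ -‿inverseʳ _ ⟩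
      0#                                 ∎)

    B⊆H : ∀ {v} → InSpan 𝔽 B v → Hyperplane G z c v
    B⊆H v∈B = InSpan-trans G (λ i → InSpan-sub G (r i) (InSpan-row G (punchIn p i)) (InSpan-row G p)) v∈B ,
              InSpan-balanced B z c B-balanced v∈B

    H⊆B : ∀ {v} → Hyperplane G z c v → InSpan 𝔽 B v
    H⊆B {v} ((a , v≡aG) , vz≡vc) = a′ , λ j → begin
      v j                                         ≡⟨ v≡aG j ⟩
      lincomb a G j                               ≡⟨ lincomb-punchIn p a G j ⟩
      a p * G p j + lincomb a′ (G ∘ punchIn p) j  ≡⟨ cong (λ x → x * G p j + lincomb a′ (G ∘ punchIn p) j) pivot ⟩
      - T * G p j + lincomb a′ (G ∘ punchIn p) j  ≡⟨ solve 3 (λ t g x → (:- t) :* g :+ x := x :- t :* g)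
                                                             refl T (G p j) _ ⟩
      lincomb a′ (G ∘ punchIn p) j - T * G p j    ≡⟨ lincomb-eliminate a′ G p r j ⟨
      lincomb a′ B j                              ∎
      where
      a′ = a ∘ punchIn p
      T = a′ ∙ r
      T*fp : T * f p ≡ a′ ∙ (f ∘ punchIn p)
      T*fp = trans (*-distribʳ-sumF (f p) (λ i → a′ i * r i))
                   (sumF-cong λ i → trans (*-assoc _ _ _) (cong (a′ i *_) (y*x⁻¹*x≡y _ fp≢0)))
      pivot : a p ≡ - T
      pivot = +-inverseˡ-unique (a p) T (xy≡0⇒y≡0 fp≢0 (begin
        f p * (a p + T)                   ≡⟨ solve 3 (λ x y t → x :* (y :+ t) := y :* x :+ t :* x)
                                                     refl (f p) (a p) T ⟩
        a p * f p + T * f p               ≡⟨ cong (a p * f p +_) T*fp ⟩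
        a p * f p + a′ ∙ (f ∘ punchIn p)  ≡⟨ sumF-punchIn p (λ i → a i * f i) ⟨
        a ∙ f                             ≡⟨ InSpan-difference G {v} a v≡aG z c ⟨
        v z - v c                         ≡⟨ x≈y⇒x∙y⁻¹≈ε vz≡vc ⟩
        0#                                ∎))

  -- Swapping two coordinates

  LinIndep-∘ : ∀ {r n s} (G : Matrix 𝔽 r n) (σ : Fin s → Fin n) (σ⁻¹ : Fin n → Fin s) →
               (∀ j → σ (σ⁻¹ j) ≡ j) → LinIndep 𝔽 G → LinIndep 𝔽 (λ i → G i ∘ σ)
  LinIndep-∘ G σ σ⁻¹ σ∘σ⁻¹≗id G-indep a a·Gσ≡0 =
    G-indep a λ j → trans (cong (lincomb a G) (sym (σ∘σ⁻¹≗id j))) (a·Gσ≡0 (σ⁻¹ j))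

  ProjectiveColumns-∘ : ∀ {r n s} (G : Matrix 𝔽 r n) (σ : Fin s → Fin n) → (∀ {j k} → σ j ≡ σ k → j ≡ k) →
                        ProjectiveColumns 𝔽 G → ProjectiveColumns 𝔽 (λ i → G i ∘ σ)
  ProjectiveColumns-∘ G σ σ-injective (nonzero , nonproportional) =
    (λ j → nonzero (σ j)) , (λ j k j≢k → nonproportional (σ j) (σ k) (j≢k ∘ σ-injective))

  module _ {m n} (G : Matrix 𝔽 (suc m) n) (z c : Fin n) where

    swapColumns : Matrix 𝔽 (suc m) n
    swapColumns i = G i ∘ transpose z c

    private
      E D : Code 𝔽 n
      E = InSpan 𝔽 G
      D = InSpan 𝔽 swapColumns

    swapped⇒InSpan : ∀ {v} → D v → E (v ∘ transpose z c)
    swapped⇒InSpan (a , v≡aGτ) = a , λ j →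
      trans (v≡aGτ (transpose z c j)) (cong (lincomb a G) (transpose-involutive z c j))

    InSpan⇒swapped : ∀ {v} → E v → D (v ∘ transpose z c)
    InSpan⇒swapped (a , v≡aG) = a , v≡aG ∘ transpose z c

    transpose-fixes : ∀ {v : Vector 𝔽 n} → v z ≡ v c → ∀ j → v (transpose z c j) ≡ v j
    transpose-fixes {v} vz≡vc j = by-cases (j Fin.≟ z) (j Fin.≟ c)
      where
      by-cases : Dec (j ≡ z) → Dec (j ≡ c) → v (transpose z c j) ≡ v j
      by-cases (yes refl) _          = trans (cong v (transpose-matchˡ z c)) (sym vz≡vc)
      by-cases (no _)     (yes refl) = trans (cong v (transpose-matchʳ z c)) vz≡vc
      by-cases (no j≢z)   (no j≢c)   = cong v (transpose-other z c j≢z j≢c)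

    Hyperplane⊆swapped : ∀ {v} → Hyperplane G z c v → D v
    Hyperplane⊆swapped (v∈E , vz≡vc) = InSpan-resp swapColumns (transpose-fixes vz≡vc) (InSpan⇒swapped v∈E)

    ⊆swapped⇒≐ : (∀ {v} → E v → D v) → _≐_ 𝔽 D E
    ⊆swapped⇒≐ E⊆D v = mk⇔ D⊆E E⊆D
      where
      D⊆E : D v → E v
      D⊆E v∈D = InSpan-resp G (cong v ∘ transpose-involutive z c) (swapped⇒InSpan (E⊆D (swapped⇒InSpan v∈D)))

    swapped-IsProjCode : LinIndep 𝔽 G → ProjectiveColumns 𝔽 G → IsProjCode 𝔽 (suc m) D
    swapped-IsProjCode G-indep G-proj =
      swapColumns ,
      (LinIndep-∘ G (transpose z c) (transpose z c) (transpose-involutive z c) G-indep , ≐-refl) ,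
      ProjectiveColumns-∘ G (transpose z c) τ-injective G-proj
      where
      τ-injective : ∀ {j k} → transpose z c j ≡ transpose z c k → j ≡ k
      τ-injective {j} {k} τj≡τk =
        trans (sym (transpose-involutive z c j)) (trans (cong (transpose z c) τj≡τk) (transpose-involutive z c k))

    -- If some v ∈ E ∩ D had v_z ≠ v_c, every x ∈ E would split as (x − λv) + λv with x − λv ∈ Hyperplane ⊆ D.
    swapped-∩⊆Hyperplane : ¬ _≐_ 𝔽 D E → ∀ {v} → E v → D v → v z ≡ v c
    swapped-∩⊆Hyperplane D≉E {v} v∈E v∈D with v z ≟ v c
    ... | yes vz≡vc = vz≡vc
    ... | no vz≢vc  = ⊥-elim (D≉E (⊆swapped⇒≐ E⊆D))
      where
      d≢0 = x≢y⇒x-y≢0 vz≢vc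
      E⊆D : ∀ {x} → E x → D x
      E⊆D {x} x∈E =
        InSpan-resp swapColumns x≗y+λv (InSpan-combine swapColumns 1# λ′ (Hyperplane⊆swapped (y∈E , y-balanced)) v∈D)
        where
        open ≡-Reasoning
        λ′ = (x z - x c) * (v z - v c) ⁻¹⟨ d≢0 ⟩
        y∈E = InSpan-sub G λ′ x∈E v∈E
        y-balanced : x z - λ′ * v z ≡ x c - λ′ * v c
        y-balanced = x∙y⁻¹≈ε⇒x≈y _ _ (begin
          (x z - λ′ * v z) - (x c - λ′ * v c)
            ≡⟨ solve 5 (λ xz xc l vz vc → (xz :- l :* vz) :- (xc :- l :* vc) := (xz :- xc) :- l :* (vz :- vc))
                       refl (x z) (x c) λ′ (v z) (v c) ⟩
          (x z - x c) - λ′ * (v z - v c)  ≡⟨ cong (λ t → (x z - x c) - t) (y*x⁻¹*x≡y _ d≢0) ⟩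
          (x z - x c) - (x z - x c)       ≡⟨ -‿inverseʳ _ ⟩
          0#                              ∎)
        x≗y+λv : ∀ j → 1# * (x j - λ′ * v j) + λ′ * v j ≡ x j
        x≗y+λv j = trans (cong (_+ λ′ * v j) (*-identityˡ _))
                         (solve 3 (λ x l v → x :- l :* v :+ l :* v := x) refl (x j) λ′ (v j))

    swapped-adjacent : ¬ _≐_ 𝔽 D E → LinIndep 𝔽 G → HasDim 𝔽 m (_∩_ 𝔽 E D)
    swapped-adjacent D≉E G-indep with ∀⊎∃¬ (λ i → G i z ≟ G i c)
    ... | inj₁ G-balanced =
      ⊥-elim (D≉E (⊆swapped⇒≐ λ {v} v∈E → Hyperplane⊆swapped (v∈E , InSpan-balanced G z c G-balanced {v} v∈E)))
    ... | inj₂ (p , Gpz≢Gpc) = HasDim-resp Hyperplane≐E∩D (Hyperplane-HasDim G G-indep z c p Gpz≢Gpc)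
      where
      Hyperplane≐E∩D : _≐_ 𝔽 (Hyperplane G z c) (_∩_ 𝔽 E D)
      Hyperplane≐E∩D v = mk⇔ (λ v∈H@(v∈E , _) → v∈E , Hyperplane⊆swapped v∈H)
                             (λ (v∈E , v∈D) → v∈E , swapped-∩⊆Hyperplane D≉E v∈E v∈D)

  transpose-sub : ∀ {n} (v : Vector 𝔽 n) {a b} → ¬ a ≡ b →
                  ∀ j → v (transpose a b j) - v j ≡ (v b - v a) * (δ 𝔽 a j - δ 𝔽 b j)
  transpose-sub v {a} {b} a≢b j = by-cases (j Fin.≟ a) (j Fin.≟ b)
    where
    open ≡-Reasoning
    d = v b - v a
    by-cases : Dec (j ≡ a) → Dec (j ≡ b) → v (transpose a b j) - v j ≡ d * (δ 𝔽 a j - δ 𝔽 b j)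
    by-cases (yes refl) _ = begin
      v (transpose a b a) - v a  ≡⟨ cong (λ k → v k - v a) (transpose-matchˡ a b) ⟩
      d                          ≡⟨ *-identityʳ d ⟨
      d * 1#                     ≡⟨ cong (d *_) (x-0#≡x 1#) ⟨
      d * (1# - 0#)              ≡⟨ cong₂ (λ x y → d * (x - y)) (δ-refl a) (δ-≢ (a≢b ∘ sym)) ⟨
      d * (δ 𝔽 a a - δ 𝔽 b a)    ∎
    by-cases (no _) (yes refl) = begin
      v (transpose a b b) - v b  ≡⟨ cong (λ k → v k - v b) (transpose-matchʳ a b) ⟩
      v a - v b                  ≡⟨ ⁻¹-anti-homo‿- (v b) (v a) ⟨
      - d                        ≡⟨ cong -_ (*-identityʳ d) ⟨
      - (d * 1#)                 ≡⟨ -‿distribʳ-* d 1# ⟩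
      d * - 1#                   ≡⟨ cong (d *_) (+-identityˡ (- 1#)) ⟨
      d * (0# - 1#)              ≡⟨ cong₂ (λ x y → d * (x - y)) (δ-≢ a≢b) (δ-refl b) ⟨
      d * (δ 𝔽 a b - δ 𝔽 b b)    ∎
    by-cases (no j≢a) (no j≢b) = begin
      v (transpose a b j) - v j  ≡⟨ cong (λ k → v k - v j) (transpose-other a b j≢a j≢b) ⟩
      v j - v j                  ≡⟨ -‿inverseʳ (v j) ⟩
      0#                         ≡⟨ zeroʳ d ⟨
      d * 0#                     ≡⟨ cong (d *_) (-‿inverseʳ 0#) ⟨
      d * (0# - 0#)              ≡⟨ cong₂ (λ x y → d * (x - y)) (δ-≢ (j≢a ∘ sym)) (δ-≢ (j≢b ∘ sym)) ⟨
      d * (δ 𝔽 a j - δ 𝔽 b j)    ∎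

  ¬transposition-invariant : ∀ {m n} (G : Matrix 𝔽 (suc m) (suc n)) → ProjectiveColumns 𝔽 G → suc m < n →
                             ¬ (∀ c {u} → InSpan 𝔽 G u → InSpan 𝔽 G (u ∘ transpose fz c))
  ¬transposition-invariant {m} {suc n} G (_ , nonproportional) 1+m<1+n invariant
    with ∀⊎∃¬ (λ r → G r (fs fz) ≟ G r fz)
  ... | inj₁ columns≡ = nonproportional (fs fz) fz (λ ()) (1# , λ r → trans (columns≡ r) (sym (*-identityˡ _)))
  ... | inj₂ (r , v₁≢v₀) = ℕ.<⇒≱ 1+m<1+n (LinIndep⇒≤ (suc m) G F F-indep F⊆E)
    where
    open ≡-Reasoning
    b : Fin (suc (suc n))
    b = fs fz
    v : Vector 𝔽 (suc (suc n))
    v = G r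
    d : Carrier
    d = v b - v fz
    d≢0 : ¬ d ≡ 0#
    d≢0 = x≢y⇒x-y≢0 v₁≢v₀
    d⁻¹ : Carrier
    d⁻¹ = d ⁻¹⟨ d≢0 ⟩

    e : Fin (suc (suc n)) → Vector 𝔽 (suc (suc n))
    e k j = δ 𝔽 k j

    e₀-e_b∈E : InSpan 𝔽 G (λ j → e fz j - e b j)
    e₀-e_b∈E = InSpan-resp G scale (InSpan-combine G d⁻¹ (- d⁻¹) (invariant b (InSpan-row G r)) (InSpan-row G r))
      where
      scale : ∀ j → d⁻¹ * v (transpose fz b j) + - d⁻¹ * v j ≡ e fz j - e b j
      scale j = begin
        d⁻¹ * v (transpose fz b j) + - d⁻¹ * v j
          ≡⟨ solve 3 (λ k x y → k :* x :+ (:- k) :* y := k :* (x :- y)) refl d⁻¹ _ (v j) ⟩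
        d⁻¹ * (v (transpose fz b j) - v j)  ≡⟨ cong (d⁻¹ *_) (transpose-sub v (λ ()) j) ⟩
        d⁻¹ * (d * (e fz j - e b j))        ≡⟨ *-assoc d⁻¹ d _ ⟨
        d⁻¹ * d * (e fz j - e b j)          ≡⟨ cong (_* (e fz j - e b j)) (x⁻¹*x≡1 d d≢0) ⟩
        1# * (e fz j - e b j)               ≡⟨ *-identityˡ _ ⟩
        e fz j - e b j                      ∎

    F : Matrix 𝔽 (suc n) (suc (suc n))
    F i j = e (punchIn b i) j - e b j

    F⊆E : ∀ i → InSpan 𝔽 G (F i)
    F⊆E i = InSpan-resp G (λ j → cong₂ _-_ (moved j) (fixed j)) (invariant (punchIn b i) e₀-e_b∈E)
      where
      τ = transpose fz (punchIn b i)
      moved : ∀ j → e fz (τ j) ≡ e (punchIn b i) j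
      moved j = trans (δ-transpose fz (punchIn b i) fz j) (cong (λ k → e k j) (transpose-matchˡ fz (punchIn b i)))
      fixed : ∀ j → e b (τ j) ≡ e b j
      fixed j = trans (δ-transpose fz (punchIn b i) b j)
                      (cong (λ k → e k j) (transpose-other fz (punchIn b i) (λ ()) (Fin.punchInᵢ≢i b i ∘ sym)))

    F-indep : LinIndep 𝔽 F
    F-indep a a·F≡0 i₀ = begin
      a i₀                           ≡⟨ sumF-δ i₀ a ⟨
      sumF 𝔽 (λ i → δ 𝔽 i₀ i * a i)  ≡⟨ sumF-cong coordinate ⟩
      lincomb a F (punchIn b i₀)     ≡⟨ a·F≡0 (punchIn b i₀) ⟩
      0#                             ∎
      where
      coordinate : ∀ i → δ 𝔽 i₀ i * a i ≡ a i * F i (punchIn b i₀)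
      coordinate i = trans (*-comm _ (a i)) (cong (a i *_) (sym (trans
        (cong₂ _-_ (δ-punchIn b i i₀) (δ-≢ (Fin.punchInᵢ≢i b i₀ ∘ sym))) (x-0#≡x _))))

  -- Equality of codes is not decidable, so maximality refutes each D ≉ ⟨G⟩ only separately; ¬¬-∀
  -- combines these finitely many double negations.
  maximalClique-nontrivial : ∀ {m n} → suc m < n → ∀ {K : Code 𝔽 (suc n) → Set₁} →
                             IsMaximalClique 𝔽 (suc n) m K → ∀ {E} → K E → ¬ (∀ C → K C → _≐_ 𝔽 C E)
  maximalClique-nontrivial {m} {n} 1+m<n {K} ((K-proj , K-adjacent) , K-maximal) {E} E∈K K≐E =
    ¬¬-∀ swapped≐ λ all-swapped≐ →
      ¬transposition-invariant G G-proj 1+m<n λ c {u} u∈⟨G⟩ →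
        Equivalence.to (all-swapped≐ c (u ∘ transpose fz c)) (InSpan⇒swapped G fz c u∈⟨G⟩)
    where
    G = proj₁ (K-proj E E∈K)
    G-indep = proj₁ (proj₁ (proj₂ (K-proj E E∈K)))
    E≐⟨G⟩ = proj₂ (proj₁ (proj₂ (K-proj E E∈K)))
    G-proj = proj₂ (proj₂ (K-proj E E∈K))

    swapped≐ : ∀ c → ¬ ¬ _≐_ 𝔽 (InSpan 𝔽 (swapColumns G fz c)) (InSpan 𝔽 G)
    swapped≐ c D≉⟨G⟩ = D≉⟨G⟩ (≐-trans D≐D′ (≐-trans (K≐E D′ D′∈K) E≐⟨G⟩))
      where
      D = InSpan 𝔽 (swapColumns G fz c)

      K′ : Code 𝔽 (suc n) → Set₁
      K′ C = K C ⊎ Lift (Level.suc 0ℓ) (_≐_ 𝔽 C D)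

      K∩D : ∀ {C} → K C → HasDim 𝔽 m (_∩_ 𝔽 C D)
      K∩D C∈K = HasDim-resp (∩-resp (≐-sym (≐-trans (K≐E _ C∈K) E≐⟨G⟩)) ≐-refl)
                            (swapped-adjacent G fz c D≉⟨G⟩ G-indep)

      K′-proj : ∀ C → K′ C → IsProjCode 𝔽 (suc m) C
      K′-proj C (inj₁ C∈K)        = K-proj C C∈K
      K′-proj C (inj₂ (lift C≐D)) = IsProjCode-resp (≐-sym C≐D) (swapped-IsProjCode G fz c G-indep G-proj)

      K′-adjacent : ∀ C C′ → K′ C → K′ C′ → ¬ _≐_ 𝔽 C C′ → HasDim 𝔽 m (_∩_ 𝔽 C C′)
      K′-adjacent C C′ (inj₁ C∈K)        (inj₁ C′∈K)        C≉C′ = K-adjacent C C′ C∈K C′∈K C≉C′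
      K′-adjacent C C′ (inj₁ C∈K)        (inj₂ (lift C′≐D)) _    =
        HasDim-resp (∩-resp ≐-refl (≐-sym C′≐D)) (K∩D C∈K)
      K′-adjacent C C′ (inj₂ (lift C≐D)) (inj₁ C′∈K)        _    =
        HasDim-resp (≐-trans (∩-comm C′ D) (∩-resp (≐-sym C≐D) ≐-refl)) (K∩D C′∈K)
      K′-adjacent C C′ (inj₂ (lift C≐D)) (inj₂ (lift C′≐D)) C≉C′ = ⊥-elim (C≉C′ (≐-trans C≐D (≐-sym C′≐D)))

      D′-witness = K-maximal K′ (K′-proj , K′-adjacent) (λ _ → inj₁) D (inj₂ (lift ≐-refl))
      D′ = proj₁ D′-witness
      D′∈K = proj₁ (proj₂ D′-witness)
      D≐D′ = proj₂ (proj₂ D′-witness)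

  -- The star of a code in standard form

  module _ {n} (w : Vector 𝔽 n) where

    appendRow-last : ∀ {m} (M : Matrix 𝔽 m n) → appendRow 𝔽 M w (Fin.fromℕ m) ≡ w
    appendRow-last {zero}  M = refl
    appendRow-last {suc m} M = appendRow-last (M ∘ fs)

    appendRow-inject₁ : ∀ {m} (M : Matrix 𝔽 m n) i → appendRow 𝔽 M w (Fin.inject₁ i) ≡ M i
    appendRow-inject₁ {suc m} M fz     = refl
    appendRow-inject₁ {suc m} M (fs i) = appendRow-inject₁ (M ∘ fs) i

    appendRow-rows : ∀ {m} (M : Matrix 𝔽 m n) i → appendRow 𝔽 M w i ≡ w ⊎ ∃ λ i′ → appendRow 𝔽 M w i ≡ M i′
    appendRow-rows {zero}  M fz     = inj₁ refl
    appendRow-rows {suc m} M fz     = inj₂ (fz , refl)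
    appendRow-rows {suc m} M (fs i) with appendRow-rows (M ∘ fs) i
    ... | inj₁ last≡w         = inj₁ last≡w
    ... | inj₂ (i′ , row≡Mi′) = inj₂ (fs i′ , row≡Mi′)

    InSpan-appendRow : ∀ {m} (M : Matrix 𝔽 m n) → _≐_ 𝔽 (InSpan 𝔽 (w ∷ M)) (InSpan 𝔽 (appendRow 𝔽 M w))
    InSpan-appendRow {m} M v = mk⇔ (InSpan-trans (appendRow 𝔽 M w) ∷⊆appendRow) (InSpan-trans (w ∷ M) appendRow⊆∷)
      where
      InSpan-row-≡ : ∀ {r} (G : Matrix 𝔽 r n) i {u} → G i ≡ u → InSpan 𝔽 G u
      InSpan-row-≡ G i Gi≡u = InSpan-resp G (cong-app Gi≡u) (InSpan-row G i)
      ∷⊆appendRow : ∀ i → InSpan 𝔽 (appendRow 𝔽 M w) ((w ∷ M) i)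
      ∷⊆appendRow fz     = InSpan-row-≡ (appendRow 𝔽 M w) (Fin.fromℕ m) (appendRow-last M)
      ∷⊆appendRow (fs i) = InSpan-row-≡ (appendRow 𝔽 M w) (Fin.inject₁ i) (appendRow-inject₁ M i)
      appendRow⊆∷ : ∀ i → InSpan 𝔽 (w ∷ M) (appendRow 𝔽 M w i)
      appendRow⊆∷ i with appendRow-rows M i
      ... | inj₁ row≡w          = InSpan-row-≡ (w ∷ M) fz (sym row≡w)
      ... | inj₂ (i′ , row≡Mi′) = InSpan-row-≡ (w ∷ M) (fs i′) (sym row≡Mi′)

  SpanOf-⊇ : ∀ {n} {P : Code 𝔽 n} {v} → P v → SpanOf 𝔽 P v
  SpanOf-⊇ {v = v} v∈P = 1 , (λ _ → v) , (λ _ → v∈P) , InSpan-row (λ _ → v) fz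

  SpanOf-nonempty : ∀ {n d} {P : Code 𝔽 n} → HasDim 𝔽 (suc d) (SpanOf 𝔽 P) → ∃ P
  SpanOf-nonempty {d = d} (g , g-indep , ⟨P⟩≐⟨g⟩) with Equivalence.from (⟨P⟩≐⟨g⟩ (g fz)) (InSpan-row g fz)
  ... | zero  , _ , _    , (_ , g₀≡0) = ⊥-elim (1≢0 (trans (sym (δ-refl (fz {d}))) (g-indep (δ 𝔽 (fz {d})) δ·g≡0 fz)))
    where
    δ·g≡0 : ∀ j → lincomb (δ 𝔽 (fz {d})) g j ≡ 0#
    δ·g≡0 j = trans (sumF-δ fz (λ i → g i j)) (g₀≡0 j)
  ... | suc _ , v , v⊆P , _ = v fz , v⊆P fz

  HasDim-1-proportional : ∀ {n} {P : Code 𝔽 n} → HasDim 𝔽 1 P → ∀ {u v} → P u → P v →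
                          ∀ {p} → ¬ u p ≡ 0# → ∃ λ s → ∀ j → v j ≡ s * u j
  HasDim-1-proportional {P = P} (g , _ , P≐⟨g⟩) {u} {v} u∈P v∈P {p} up≢0 = s , λ j → begin
    v j                           ≡⟨ on-line v∈P j ⟩
    b * g fz j                    ≡⟨ cong (_* g fz j) (y*x⁻¹*x≡y b a≢0) ⟨
    b * a ⁻¹⟨ a≢0 ⟩ * a * g fz j  ≡⟨ *-assoc s a (g fz j) ⟩
    s * (a * g fz j)              ≡⟨ cong (s *_) (on-line u∈P j) ⟨
    s * u j                       ∎
    where
    open ≡-Reasoning
    coefficient : ∀ {x} → P x → Carrier
    coefficient {x} x∈P = proj₁ (Equivalence.to (P≐⟨g⟩ x) x∈P) fz
    on-line : ∀ {x} (x∈P : P x) j → x j ≡ coefficient x∈P * g fz j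
    on-line {x} x∈P j = trans (proj₂ (Equivalence.to (P≐⟨g⟩ x) x∈P) j) (+-identityʳ _)
    a b : Carrier
    a = coefficient u∈P
    b = coefficient v∈P
    a≢0 : ¬ a ≡ 0#
    a≢0 a≡0 = up≢0 (trans (on-line u∈P p) (trans (cong (_* g fz p) a≡0) (zeroˡ _)))
    s = b * a ⁻¹⟨ a≢0 ⟩

  module _ {m n} (m≤n : m ≤ n) (M : Matrix 𝔽 m n) (M-standard : ∀ i j → toℕ j < m → M i j ≡ δ 𝔽 i j) where

    private
      ι : Fin m → Fin n
      ι i = inject≤ i m≤n

    lincomb-standard : ∀ c i₀ → lincomb c M (ι i₀) ≡ c i₀
    lincomb-standard c i₀ = trans (sumF-cong entry) (sumF-δ i₀ c)
      where
      entry : ∀ i → c i * M i (ι i₀) ≡ δ 𝔽 i₀ i * c i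
      entry i = trans (*-comm (c i) _) (cong (_* c i) (begin
        M i (ι i₀)    ≡⟨ M-standard i (ι i₀) (subst (_< m) (sym (Fin.toℕ-inject≤ i₀ m≤n)) (Fin.toℕ<n i₀)) ⟩
        δ 𝔽 i (ι i₀)  ≡⟨ δ-congʳ i (Fin.toℕ-inject≤ i₀ m≤n) ⟩
        δ 𝔽 i i₀      ≡⟨ δ-sym i i₀ ⟩
        δ 𝔽 i₀ i      ∎))
        where open ≡-Reasoning

    -- v minus the combination of rows of M that agrees with v on the first m coordinates
    reduce : Vector 𝔽 n → Vector 𝔽 n
    reduce v j = v j - lincomb (v ∘ ι) M j

    reduce-ι : ∀ v i → reduce v (ι i) ≡ 0#
    reduce-ι v i = trans (cong (λ x → v (ι i) - x) (lincomb-standard (v ∘ ι) i)) (-‿inverseʳ _)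

    reduce-< : ∀ v j → toℕ j < m → reduce v j ≡ 0#
    reduce-< v j j<m = trans (cong (reduce v) (sym ι[j]≡j)) (reduce-ι v (Fin.fromℕ< j<m))
      where
      ι[j]≡j : ι (Fin.fromℕ< j<m) ≡ j
      ι[j]≡j = Fin.toℕ-injective (trans (Fin.toℕ-inject≤ _ m≤n) (Fin.toℕ-fromℕ< j<m))

    reduce-decomposition : ∀ v j → v j ≡ reduce v j + lincomb (v ∘ ι) M j
    reduce-decomposition v j = solve 2 (λ x y → x := x :- y :+ y) refl (v j) _

    reduce∈Span : ∀ v → InSpan 𝔽 (v ∷ M) (reduce v)
    reduce∈Span v = (1# ∷ λ i → - v (ι i)) , λ j → cong₂ _+_ (sym (*-identityˡ (v j)))
      (trans (-‿sumF (λ i → v (ι i) * M i j)) (sumF-cong λ i → -‿distribˡ-* (v (ι i)) (M i j)))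

    LinIndep-echelon : ∀ {u w : Vector 𝔽 n} p q → (∀ i → u (ι i) ≡ 0#) → (∀ i → w (ι i) ≡ 0#) →
                       u p ≡ 0# → ¬ w p ≡ 0# → ¬ u q ≡ 0# → LinIndep 𝔽 (u ∷ w ∷ M)
    LinIndep-echelon {u} {w} p q u-ι≡0 w-ι≡0 up≡0 wp≢0 uq≢0 a a·F≡0 = a≡0
      where
      open ≡-Reasoning
      a₀ a₁ : Carrier
      a₀ = a fz
      a₁ = a (fs fz)
      a₂ : Fin m → Carrier
      a₂ = a ∘ fs ∘ fs

      drop-zeros : ∀ {x y} j → x ≡ 0# → y ≡ 0# → a₀ * x + (a₁ * y + lincomb a₂ M j) ≡ lincomb a₂ M j
      drop-zeros j x≡0 y≡0 = trans (cong₂ (λ x y → a₀ * x + (a₁ * y + lincomb a₂ M j)) x≡0 y≡0)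
        (trans (cong₂ (λ x y → x + (y + lincomb a₂ M j)) (zeroʳ a₀) (zeroʳ a₁))
               (trans (+-identityˡ _) (+-identityˡ _)))

      a₂≡0 : ∀ i → a₂ i ≡ 0#
      a₂≡0 i = begin
        a₂ i                         ≡⟨ lincomb-standard a₂ i ⟨
        lincomb a₂ M (ι i)           ≡⟨ drop-zeros (ι i) (u-ι≡0 i) (w-ι≡0 i) ⟨
        lincomb a (u ∷ w ∷ M) (ι i)  ≡⟨ a·F≡0 (ι i) ⟩
        0#                           ∎

      M-part≡0 : ∀ j → lincomb a₂ M j ≡ 0#
      M-part≡0 j = sumF-zero λ i → trans (cong (_* M i j) (a₂≡0 i)) (zeroˡ (M i j))

      a₁≡0 : a₁ ≡ 0#
      a₁≡0 = xy≡0⇒y≡0 wp≢0 (begin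
        w p * a₁                                ≡⟨ *-comm (w p) a₁ ⟩
        a₁ * w p                                ≡⟨ trans (+-identityˡ _) (+-identityʳ _) ⟨
        0# + (a₁ * w p + 0#)                    ≡⟨ cong₂ (λ x y → x + (a₁ * w p + y))
                                                         (trans (cong (a₀ *_) up≡0) (zeroʳ a₀)) (M-part≡0 p) ⟨
        a₀ * u p + (a₁ * w p + lincomb a₂ M p)  ≡⟨ a·F≡0 p ⟩
        0#                                      ∎)

      a₀≡0 : a₀ ≡ 0#
      a₀≡0 = xy≡0⇒y≡0 uq≢0 (begin
        u q * a₀                                ≡⟨ *-comm (u q) a₀ ⟩
        a₀ * u q                                ≡⟨ trans (cong (a₀ * u q +_) (+-identityˡ 0#)) (+-identityʳ _) ⟨
        a₀ * u q + (0# + 0#)                    ≡⟨ cong₂ (λ x y → a₀ * u q + (x + y))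
                                                         (trans (cong (_* w q) a₁≡0) (zeroˡ (w q))) (M-part≡0 q) ⟨
        a₀ * u q + (a₁ * w q + lincomb a₂ M q)  ≡⟨ a·F≡0 q ⟩
        0#                                      ∎)

      a≡0 : ∀ i → a i ≡ 0#
      a≡0 fz          = a₀≡0
      a≡0 (fs fz)     = a₁≡0
      a≡0 (fs (fs i)) = a₂≡0 i

    module _ (G : Matrix 𝔽 (suc m) n) (G-indep : LinIndep 𝔽 G) (M⊆G : ∀ i → InSpan 𝔽 G (M i)) where

      ∷M⊆G : ∀ {v} → InSpan 𝔽 G v → ∀ i → InSpan 𝔽 G ((v ∷ M) i)
      ∷M⊆G v∈G fz     = v∈G
      ∷M⊆G v∈G (fs i) = M⊆G i

      reduce∈G : ∀ {v} → InSpan 𝔽 G v → InSpan 𝔽 G (reduce v)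
      reduce∈G {v} v∈G = InSpan-trans G (∷M⊆G v∈G) (reduce∈Span v)

      reduced-row-nonzero : ∃ λ r → ∃ λ p → ¬ reduce (G r) p ≡ 0#
      reduced-row-nonzero with matrix-zero⊎nonzero (reduce ∘ G)
      ... | inj₂ r,p,≢0    = r,p,≢0
      ... | inj₁ reduced≡0 = ⊥-elim (ℕ.n≮n m (LinIndep⇒≤ m M G G-indep G⊆M))
        where
        G⊆M : ∀ r → InSpan 𝔽 M (G r)
        G⊆M r = G r ∘ ι , λ j → trans (reduce-decomposition (G r) j)
                                (trans (cong (_+ lincomb (G r ∘ ι) M j) (reduced≡0 r j)) (+-identityˡ _))

      -- A v ∈ ⟨G⟩ whose reduction is not a multiple of w would give m + 2 independent vectors u ∷ w ∷ M.
      ⟨G⟩⊆⟨w∷M⟩ : ∀ {w p} → InSpan 𝔽 G w → (∀ i → w (ι i) ≡ 0#) → ¬ w p ≡ 0# →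
                  ∀ {v} → InSpan 𝔽 G v → InSpan 𝔽 (w ∷ M) v
      ⟨G⟩⊆⟨w∷M⟩ {w} {p} w∈G w-ι≡0 wp≢0 {v} v∈G = by-cases (vector-zero⊎nonzero u)
        where
        λ′ : Carrier
        λ′ = reduce v p * w p ⁻¹⟨ wp≢0 ⟩
        u : Vector 𝔽 n
        u j = reduce v j - λ′ * w j

        u-ι≡0 : ∀ i → u (ι i) ≡ 0#
        u-ι≡0 i = trans (cong₂ (λ x y → x - λ′ * y) (reduce-ι v i) (w-ι≡0 i))
                        (trans (cong (λ x → 0# - x) (zeroʳ λ′)) (-‿inverseʳ 0#))

        up≡0 : u p ≡ 0#
        up≡0 = trans (cong (λ x → reduce v p - x) (y*x⁻¹*x≡y _ wp≢0)) (-‿inverseʳ _)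

        F⊆G : ∀ i → InSpan 𝔽 G ((u ∷ w ∷ M) i)
        F⊆G fz     = InSpan-sub G λ′ (reduce∈G v∈G) w∈G
        F⊆G (fs i) = ∷M⊆G w∈G i

        by-cases : (∀ j → u j ≡ 0#) ⊎ ∃ (λ q → ¬ u q ≡ 0#) → InSpan 𝔽 (w ∷ M) v
        by-cases (inj₁ u≡0)        = (λ′ ∷ v ∘ ι) , λ j →
          trans (reduce-decomposition v j) (cong (_+ lincomb (v ∘ ι) M j) (x∙y⁻¹≈ε⇒x≈y _ _ (u≡0 j)))
        by-cases (inj₂ (q , uq≢0)) = ⊥-elim (ℕ.n≮n (suc m)
          (LinIndep⇒≤ (suc m) G (u ∷ w ∷ M) (LinIndep-echelon p q u-ι≡0 w-ι≡0 up≡0 wp≢0 uq≢0) F⊆G))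

    StandardForm : Code 𝔽 n → Set
    StandardForm C = Σ (Vector 𝔽 n) λ w → WSet 𝔽 M w × (∃ λ p → ¬ w p ≡ 0#) × _≐_ 𝔽 C (InSpan 𝔽 (w ∷ M))

    Star-standardForm : ∀ {S C : Code 𝔽 n} → GeneratorMatrix 𝔽 M S → IsProjCode 𝔽 (suc m) C → (∀ v → S v → C v) →
                        StandardForm C
    Star-standardForm {S} {C} (_ , S≐⟨M⟩) C-proj@(G , (G-indep , C≐⟨G⟩) , _) S⊆C =
      w , (reduce-< (G r) , IsProjCode-resp C≐⟨appendRow⟩ C-proj) , (p , wp≢0) , C≐⟨w∷M⟩
      where
      M⊆G : ∀ i → InSpan 𝔽 G (M i)
      M⊆G i = Equivalence.to (C≐⟨G⟩ (M i)) (S⊆C (M i) (Equivalence.from (S≐⟨M⟩ (M i)) (InSpan-row M i)))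

      r : Fin (suc m)
      r = proj₁ (reduced-row-nonzero G G-indep M⊆G)
      p : Fin n
      p = proj₁ (proj₂ (reduced-row-nonzero G G-indep M⊆G))
      w : Vector 𝔽 n
      w = reduce (G r)
      wp≢0 : ¬ w p ≡ 0#
      wp≢0 = proj₂ (proj₂ (reduced-row-nonzero G G-indep M⊆G))
      w∈G : InSpan 𝔽 G w
      w∈G = reduce∈G G G-indep M⊆G (InSpan-row G r)

      C≐⟨w∷M⟩ : _≐_ 𝔽 C (InSpan 𝔽 (w ∷ M))
      C≐⟨w∷M⟩ v = mk⇔ (λ v∈C → ⟨G⟩⊆⟨w∷M⟩ G G-indep M⊆G w∈G (reduce-ι (G r)) wp≢0 (Equivalence.to (C≐⟨G⟩ v) v∈C))
                      (λ v∈⟨w∷M⟩ → Equivalence.from (C≐⟨G⟩ v) (InSpan-trans G (∷M⊆G G G-indep M⊆G w∈G) v∈⟨w∷M⟩))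

      C≐⟨appendRow⟩ : _≐_ 𝔽 C (InSpan 𝔽 (appendRow 𝔽 M w))
      C≐⟨appendRow⟩ = ≐-trans C≐⟨w∷M⟩ (InSpan-appendRow w M)

    Star-appendRow : ∀ {S : Code 𝔽 n} → GeneratorMatrix 𝔽 M S → ∀ {w} → WSet 𝔽 M w →
                     Star 𝔽 (suc m) S (InSpan 𝔽 (appendRow 𝔽 M w))
    Star-appendRow (_ , S≐⟨M⟩) {w} (_ , w-proj) = lift (w-proj , λ v v∈S →
      Equivalence.to (InSpan-appendRow w M v) (InSpan-∷ M w (Equivalence.to (S≐⟨M⟩ v) v∈S)))

    ⟨w∷M⟩≐⟨w′∷M⟩ : HasDim 𝔽 1 (SpanOf 𝔽 (WSet 𝔽 M)) → ∀ {w w′ p p′} → WSet 𝔽 M w → WSet 𝔽 M w′ →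
                ¬ w p ≡ 0# → ¬ w′ p′ ≡ 0# → _≐_ 𝔽 (InSpan 𝔽 (w ∷ M)) (InSpan 𝔽 (w′ ∷ M))
    ⟨w∷M⟩≐⟨w′∷M⟩ W-line w∈W w′∈W wp≢0 w′p′≢0 v =
      mk⇔ (InSpan-∷-scaled M _ (proj₂ (proportional w′∈W w∈W w′p′≢0)))
          (InSpan-∷-scaled M _ (proj₂ (proportional w∈W w′∈W wp≢0)))
      where
      proportional : ∀ {u v} → WSet 𝔽 M u → WSet 𝔽 M v → ∀ {q} → ¬ u q ≡ 0# → ∃ λ s → ∀ j → v j ≡ s * u j
      proportional u∈W v∈W = HasDim-1-proportional W-line (SpanOf-⊇ u∈W) (SpanOf-⊇ v∈W)

    Star-≐ : ∀ {S : Code 𝔽 n} → GeneratorMatrix 𝔽 M S → HasDim 𝔽 1 (SpanOf 𝔽 (WSet 𝔽 M)) →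
             ∀ {C C′} → Star 𝔽 (suc m) S C → Star 𝔽 (suc m) S C′ → _≐_ 𝔽 C C′
    Star-≐ M-generates W-line (lift (C-proj , S⊆C)) (lift (C′-proj , S⊆C′)) =
      combine (Star-standardForm M-generates C-proj S⊆C) (Star-standardForm M-generates C′-proj S⊆C′)
      where
      combine : ∀ {C C′} → StandardForm C → StandardForm C′ → _≐_ 𝔽 C C′
      combine (w , w∈W , (_ , wp≢0) , C≐⟨w∷M⟩) (w′ , w′∈W , (_ , w′p′≢0) , C′≐⟨w′∷M⟩) =
        ≐-trans C≐⟨w∷M⟩ (≐-trans (⟨w∷M⟩≐⟨w′∷M⟩ W-line w∈W w′∈W wp≢0 w′p′≢0) (≐-sym C′≐⟨w′∷M⟩))

corollary1 : (𝔽 : FiniteField) (n m : ℕ) → 1 ≤ m → suc m < n ∸ 1 →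
    (M : Matrix 𝔽 m n) →
    (∀ i j → toℕ j < m → M i j ≡ δ 𝔽 i j) →
    (S : Code 𝔽 n) → GeneratorMatrix 𝔽 M S →
    HasDim 𝔽 1 (SpanOf 𝔽 (WSet 𝔽 M)) →
    ¬ IsMaximalClique 𝔽 n m (Star 𝔽 (suc m) S)
corollary1 𝔽 zero    m _ ()
corollary1 𝔽 (suc n) m _ 1+m<n M M-standard S M-generates W-line maximal =
  maximalClique-nontrivial 𝔽 1+m<n maximal C₀∈Star λ C C∈Star →
    Star-≐ 𝔽 m≤1+n M M-standard M-generates W-line C∈Star C₀∈Star
  where
  m≤1+n : m ≤ suc n
  m≤1+n = ℕ.m≤n⇒m≤1+n (ℕ.<⇒≤ (ℕ.<-trans (ℕ.n<1+n m) 1+m<n))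
  w₀∈W = proj₂ (SpanOf-nonempty 𝔽 {P = WSet 𝔽 M} W-line)
  C₀∈Star = Star-appendRow 𝔽 m≤1+n M M-standard M-generates w₀∈W
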